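{- For all integers $k,m\geq 0$, $\overline{C}_{3,1}(2^k(6m+5))\equiv 0\pmod 8$.
   Context: An overpartition of $n$ is a partition of $n$ in which the first occurrence of each distinct part may optionally be overlined. $\overline{C}_{3,1}(n)$ denotes the number of overpartitions of $n$ in which no part is divisible by $3$ and only parts congruent to $\pm 1 \pmod{3}$ may be overlined; equivalently $\sum_{n\ge0}\overline{C}_{3,1}(n)q^n=\frac{(q^3;q^3)_\infty(-q;q^3)_\infty(-q^2;q^3)_\infty}{(q;q)_\infty}$, where $(A;q)_\infty=\prod_{j\ge0}(1-Aq^j)$. -}

module Defs where

open import Data.Nat using (ℕ; zero; suc; _+_; _*_; _∸_; _≤ᵇ_; _%_)
open import Data.Nat.Properties using ()
open import Data.List using (List; map; upTo)
open import Data.Nat.ListAction using (sum)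
open import Data.Bool using (Bool; true; false; if_then_else_)

-- Weighted count of (ordinary) partitions of n into parts from {1,…,j}
-- that are not divisible by 3, where a partition is weighted by
-- 2^(number of distinct part sizes): each distinct part size occurring
-- c ≥ 1 times contributes a factor 2, namely whether its first occurrence
-- is overlined or not.  Since every part not divisible by 3 is ≡ ±1 (mod 3),
-- every such part may be overlined.  Hence W j n counts the overpartitions
-- of n counted by C̄_{3,1} whose parts are all ≤ j.
W : ℕ → ℕ → ℕ
W zero n = if n ≤ᵇ 0 then 1 else 0
W (suc j) n with suc j % 3
... | zero = W j n
... | suc _ = W j n + 2 * sum (map (λ c → let u = suc c * suc j in
                                   if u ≤ᵇ n then W j (n ∸ u) else 0) (upTo n))

C̄₃₁ : ℕ → ℕ
C̄₃₁ n = W n n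

module Submission where

-- The generating function of C̄₃₁ is ∏_{3 ∤ j} (1 + 2 q^j/(1 − q^j)), so an overpartition whose
-- parts have d distinct sizes carries the weight 2^d and, modulo 8, only d = 1 and d = 2
-- contribute: C̄₃₁(N) ≡ 2·W₁(N) + 4·W₂(N).  Let N = 2^k (6m + 5); then 3 ∤ N and N ≠ x² + 3y².
--
-- W₁(N) is the number of divisors of N, i.e. twice the number of factorizations N = x·y with
-- x < y, which we split by the parity of y − x into Y + D (oddGapPairs and evenGapPairs).
-- Partitions into two sizes s < s + t with multiplicities v and u (N = u(s + t) + v s) are
-- counted by W₂(N) when 3 divides neither size; those in which one size is divisible by 3 come
-- in pairs (the two swaps of size with multiplicity leave N fixed, and a common fixed point would
-- give N = x² + 3y²).  On all of them, (s, t, u, v) ↦ (u, v, s, t) is an involution whose fixed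
-- points N = s (s + 2t) are the factorizations with even y − x.  Hence W₂(N) ≡ D (mod 2) and
-- C̄₃₁(N) ≡ 4Y (mod 8).  Finally Y = 0 for odd N, while for even N a factorization with y − x odd
-- is determined by its odd factor, so Y is the number of divisors of the non-square 6m + 5,
-- which is even.

open import Defs
open import Data.Nat using (ℕ; _+_; _*_; _^_)
open import Data.Nat.Divisibility using (_∣_)

open import Data.Bool using (true; false; if_then_else_)
open import Data.List using (map; upTo; applyUpTo)
open import Data.Nat.Base using (zero; suc; _∸_; _≤_; _<_; _>_; _≤ᵇ_; _≡ᵇ_; _%_; s≤s; parity)
open import Data.Nat.Divisibility
  using (divides; _∣?_; m%n≡0⇒n∣m; ∣m∣n⇒∣m+n; ∣m+n∣m⇒∣n; ∣m⇒∣m*n; ∣n⇒∣m*n; m∣m*n;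
         *-monoʳ-∣)
open import Data.Nat.DivMod using ([m+kn]%n≡m%n; %-distribˡ-*; %-remove-+ʳ; m%n<n)
open import Data.Nat.ListAction using (sum)
open import Data.Nat.Primality using (Prime; prime?; euclidsLemma)
open import Data.Nat.Properties
open import Data.Nat.Tactic.RingSolver using (solve-∀)
open import Data.Parity.Base as ℙ using (Parity; 0ℙ; 1ℙ)
import Data.Parity.Properties as ℙ
open import Data.Product using (∃-syntax; _,_; _×_; proj₂)
open import Data.Sum using (_⊎_; inj₁; inj₂)
open import Function using (id; _∘_)
open import Relation.Binary.PropositionalEquality
open import Relation.Nullary using (¬_; yes; no; contradiction; ofʸ; ofⁿ)
open import Relation.Nullary.Decidable using (from-yes; from-no)
open ≡-Reasoning

-- Finite sums

∑ : ℕ → (ℕ → ℕ) → ℕ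
∑ zero    f = 0
∑ (suc n) f = ∑ n f + f n

infix 6.5 ∑
syntax ∑ n (λ x → e) = ∑[ x < n ] e

∑-cong : ∀ n {f g : ℕ → ℕ} → (∀ x → x < n → f x ≡ g x) → ∑ n f ≡ ∑ n g
∑-cong zero    f≡g = refl
∑-cong (suc n) f≡g = cong₂ _+_ (∑-cong n λ x x<n → f≡g x (m<n⇒m<1+n x<n)) (f≡g n ≤-refl)

∑-≡0 : ∀ n {f : ℕ → ℕ} → (∀ x → x < n → f x ≡ 0) → ∑ n f ≡ 0
∑-≡0 n f≡0 = trans (∑-cong n f≡0) (∑-zeros n)
  where
  ∑-zeros : ∀ n → ∑[ _ < n ] 0 ≡ 0
  ∑-zeros zero    = refl
  ∑-zeros (suc n) = cong (_+ 0) (∑-zeros n)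

∑-distrib-+ : ∀ n (f g : ℕ → ℕ) → ∑[ x < n ] (f x + g x) ≡ ∑ n f + ∑ n g
∑-distrib-+ zero    f g = refl
∑-distrib-+ (suc n) f g = begin
  ∑[ x < n ] (f x + g x) + (f n + g n) ≡⟨ cong (_+ (f n + g n)) (∑-distrib-+ n f g) ⟩
  ∑ n f + ∑ n g + (f n + g n)          ≡⟨ +-+-interchange (∑ n f) (∑ n g) (f n) (g n) ⟩
  ∑ n f + f n + (∑ n g + g n)          ∎
  where
  +-+-interchange : ∀ a b c d → a + b + (c + d) ≡ a + c + (b + d)
  +-+-interchange = solve-∀

*-distribˡ-∑ : ∀ k n (f : ℕ → ℕ) → k * ∑ n f ≡ ∑[ x < n ] k * f x
*-distribˡ-∑ k zero    f = *-zeroʳ k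
*-distribˡ-∑ k (suc n) f = begin
  k * (∑ n f + f n)            ≡⟨ *-distribˡ-+ k (∑ n f) (f n) ⟩
  k * ∑ n f + k * f n          ≡⟨ cong (_+ k * f n) (*-distribˡ-∑ k n f) ⟩
  ∑[ x < n ] k * f x + k * f n ∎

∑-comm : ∀ m n (f : ℕ → ℕ → ℕ) → ∑[ x < m ] ∑[ y < n ] f x y ≡ ∑[ y < n ] ∑[ x < m ] f x y
∑-comm zero    n f = sym (∑-≡0 n λ _ _ → refl)
∑-comm (suc m) n f = begin
  ∑[ x < m ] ∑[ y < n ] f x y + ∑[ y < n ] f m y ≡⟨ cong (_+ ∑[ y < n ] f m y) (∑-comm m n f) ⟩
  ∑[ y < n ] ∑[ x < m ] f x y + ∑[ y < n ] f m y ≡⟨ ∑-distrib-+ n (λ y → ∑[ x < m ] f x y) (f m) ⟨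
  ∑[ y < n ] (∑[ x < m ] f x y + f m y)         ∎

∑-++ : ∀ m n (f : ℕ → ℕ) → ∑ (m + n) f ≡ ∑ m f + ∑[ x < n ] f (m + x)
∑-++ m zero    f = trans (cong (λ k → ∑ k f) (+-identityʳ m)) (sym (+-identityʳ (∑ m f)))
∑-++ m (suc n) f rewrite +-suc m n | ∑-++ m n f = +-assoc (∑ m f) _ _

∑-truncate : ∀ {m n} (f : ℕ → ℕ) → m ≤ n → (∀ x → m ≤ x → f x ≡ 0) → ∑ n f ≡ ∑ m f
∑-truncate {m} {n} f m≤n f≡0 = begin
  ∑ n f                            ≡⟨ cong (λ k → ∑ k f) (m+[n∸m]≡n m≤n) ⟨
  ∑ (m + (n ∸ m)) f                ≡⟨ ∑-++ m (n ∸ m) f ⟩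
  ∑ m f + ∑[ x < n ∸ m ] f (m + x) ≡⟨ cong (∑ m f +_) (∑-≡0 (n ∸ m) λ x _ → f≡0 (m + x) (m≤m+n m x)) ⟩
  ∑ m f + 0                        ≡⟨ +-identityʳ (∑ m f) ⟩
  ∑ m f                            ∎

∑-blocks : ∀ k n (f : ℕ → ℕ) → ∑ (n * k) f ≡ ∑[ j < n ] ∑[ r < k ] f (j * k + r)
∑-blocks k zero    f = refl
∑-blocks k (suc n) f = begin
  ∑ (k + n * k) f
    ≡⟨ cong (λ l → ∑ l f) (+-comm k (n * k)) ⟩
  ∑ (n * k + k) f
    ≡⟨ ∑-++ (n * k) k f ⟩
  ∑ (n * k) f + ∑[ r < k ] f (n * k + r)
    ≡⟨ cong (_+ ∑[ r < k ] f (n * k + r)) (∑-blocks k n f) ⟩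
  ∑[ j < n ] ∑[ r < k ] f (j * k + r) + ∑[ r < k ] f (n * k + r) ∎

∑-even-odd : ∀ n (f : ℕ → ℕ) → ∑ (n * 2) f ≡ ∑[ j < n ] f (j * 2) + ∑[ j < n ] f (j * 2 + 1)
∑-even-odd n f = begin
  ∑ (n * 2) f
    ≡⟨ ∑-blocks 2 n f ⟩
  ∑[ j < n ] (0 + f (j * 2 + 0) + f (j * 2 + 1))
    ≡⟨ ∑-cong n (λ j _ → cong (λ i → f i + f (j * 2 + 1)) (+-identityʳ (j * 2))) ⟩
  ∑[ j < n ] (f (j * 2) + f (j * 2 + 1))
    ≡⟨ ∑-distrib-+ n _ _ ⟩
  ∑[ j < n ] f (j * 2) + ∑[ j < n ] f (j * 2 + 1) ∎

∑-triangle : ∀ L (f : ℕ → ℕ → ℕ) → (∀ a b → L ≤ a → f a b ≡ 0) →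
             ∑[ a < L ] ∑[ b < a ] f a b ≡ ∑[ b < L ] ∑[ d < L ] f (suc b + d) b
∑-triangle L f f≡0 = trans (reindex L) (∑-cong L λ b b<L →
  sym (∑-truncate _ (m∸n≤m L (suc b)) λ d L∸sb≤d →
    f≡0 _ b (≤-trans (≤-reflexive (sym (m+[n∸m]≡n b<L))) (+-monoʳ-≤ (suc b) L∸sb≤d))))
  where
  reindex : ∀ L → ∑[ a < L ] ∑[ b < a ] f a b ≡ ∑[ b < L ] ∑[ d < L ∸ suc b ] f (suc b + d) b
  reindex zero    = refl
  reindex (suc L) = begin
    ∑[ a < L ] ∑[ b < a ] f a b + ∑[ b < L ] f L b
      ≡⟨ cong (_+ ∑[ b < L ] f L b) (reindex L) ⟩
    ∑[ b < L ] ∑[ d < L ∸ suc b ] f (suc b + d) b + ∑[ b < L ] f L b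
      ≡⟨ ∑-distrib-+ L _ _ ⟨
    ∑[ b < L ] (∑[ d < L ∸ suc b ] f (suc b + d) b + f L b)
      ≡⟨ ∑-cong L (λ b b<L →
           trans (cong (λ l → ∑[ d < L ∸ suc b ] f (suc b + d) b + f l b) (sym (m+[n∸m]≡n b<L)))
                 (cong (λ k → ∑[ d < k ] f (suc b + d) b) (sym (+-∸-assoc 1 b<L)))) ⟩
    ∑[ b < L ] ∑[ d < L ∸ b ] f (suc b + d) b
      ≡⟨ +-identityʳ _ ⟨
    ∑[ b < L ] ∑[ d < L ∸ b ] f (suc b + d) b + 0
      ≡⟨ cong (λ k → ∑[ b < L ] ∑[ d < L ∸ b ] f (suc b + d) b + ∑[ d < k ] f (suc L + d) L) (n∸n≡0 L) ⟨
    ∑[ b < suc L ] ∑[ d < L ∸ b ] f (suc b + d) b ∎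

∑²-split : ∀ L (g : ℕ → ℕ → ℕ) →
           ∑[ a < L ] ∑[ b < L ] g a b ≡
           ∑[ a < L ] ∑[ b < a ] g a b + ∑[ a < L ] ∑[ b < a ] g b a + ∑[ a < L ] g a a
∑²-split zero    g = refl
∑²-split (suc L) g = begin
  ∑[ a < L ] (∑[ b < L ] g a b + g a L) + (∑[ b < L ] g L b + g L L)
    ≡⟨ cong (_+ (∑[ b < L ] g L b + g L L)) (∑-distrib-+ L _ _) ⟩
  ∑[ a < L ] ∑[ b < L ] g a b + ∑[ a < L ] g a L + (∑[ b < L ] g L b + g L L)
    ≡⟨ cong (λ s → s + ∑[ a < L ] g a L + (∑[ b < L ] g L b + g L L)) (∑²-split L g) ⟩
  ∑[ a < L ] ∑[ b < a ] g a b + ∑[ a < L ] ∑[ b < a ] g b a + ∑[ a < L ] g a a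
    + ∑[ a < L ] g a L + (∑[ b < L ] g L b + g L L)
    ≡⟨ regroup (∑[ a < L ] ∑[ b < a ] g a b) (∑[ a < L ] ∑[ b < a ] g b a) (∑[ a < L ] g a a)
               (∑[ b < L ] g L b) (∑[ a < L ] g a L) (g L L) ⟩
  ∑[ a < L ] ∑[ b < a ] g a b + ∑[ b < L ] g L b + (∑[ a < L ] ∑[ b < a ] g b a + ∑[ a < L ] g a L)
    + (∑[ a < L ] g a a + g L L) ∎
  where
  regroup : ∀ t t′ d r c e → t + t′ + d + c + (r + e) ≡ t + r + (t′ + c) + (d + e)
  regroup = solve-∀

∑²-symmetric : ∀ L (g : ℕ → ℕ → ℕ) → (∀ a b → g a b ≡ g b a) →
               ∑[ a < L ] ∑[ b < L ] g a b ≡ 2 * (∑[ a < L ] ∑[ b < a ] g a b) + ∑[ a < L ] g a a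
∑²-symmetric L g g-sym = begin
  ∑[ a < L ] ∑[ b < L ] g a b                         ≡⟨ ∑²-split L g ⟩
  T + ∑[ a < L ] ∑[ b < a ] g b a + ∑[ a < L ] g a a  ≡⟨ cong (λ t → T + t + ∑[ a < L ] g a a)
                                                            (∑-cong L λ a _ → ∑-cong a λ b _ → g-sym b a) ⟩
  T + T + ∑[ a < L ] g a a                            ≡⟨ cong (λ t → T + t + ∑[ a < L ] g a a) (+-identityʳ T) ⟨
  2 * T + ∑[ a < L ] g a a                            ∎
  where
  T : ℕ
  T = ∑[ a < L ] ∑[ b < a ] g a b

∑⁴-pair-swap : ∀ L (h : ℕ → ℕ → ℕ → ℕ → ℕ) → (∀ a b c d → h a b c d ≡ h c d a b) →
               ∃[ u ] ∑[ a < L ] ∑[ b < L ] ∑[ c < L ] ∑[ d < L ] h a b c d ≡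
                      2 * u + ∑[ a < L ] ∑[ b < L ] h a b a b
∑⁴-pair-swap L h h-swap = T + ∑[ a < L ] Tₐ a , (begin
  ∑[ a < L ] ∑[ b < L ] ∑[ c < L ] ∑[ d < L ] h a b c d
    ≡⟨ ∑-cong L (λ a _ → ∑-comm L L λ b c → ∑[ d < L ] h a b c d) ⟩
  ∑[ a < L ] ∑[ c < L ] H a c
    ≡⟨ ∑²-symmetric L H H-sym ⟩
  2 * T + ∑[ a < L ] H a a
    ≡⟨ cong (2 * T +_) (∑-cong L λ a _ → ∑²-symmetric L (λ b d → h a b a d) λ b d → h-swap a b a d) ⟩
  2 * T + ∑[ a < L ] (2 * Tₐ a + ∑[ b < L ] h a b a b)
    ≡⟨ cong (2 * T +_) (∑-distrib-+ L _ _) ⟩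
  2 * T + (∑[ a < L ] 2 * Tₐ a + ∑[ a < L ] ∑[ b < L ] h a b a b)
    ≡⟨ cong (λ s → 2 * T + (s + ∑[ a < L ] ∑[ b < L ] h a b a b)) (*-distribˡ-∑ 2 L Tₐ) ⟨
  2 * T + (2 * (∑[ a < L ] Tₐ a) + ∑[ a < L ] ∑[ b < L ] h a b a b)
    ≡⟨ factor-2 T _ _ ⟩
  2 * (T + ∑[ a < L ] Tₐ a) + ∑[ a < L ] ∑[ b < L ] h a b a b ∎)
  where
  H : ℕ → ℕ → ℕ
  H a c = ∑[ b < L ] ∑[ d < L ] h a b c d
  H-sym : ∀ a c → H a c ≡ H c a
  H-sym a c = trans (∑-cong L λ b _ → ∑-cong L λ d _ → h-swap a b c d) (∑-comm L L λ b d → h c d a b)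
  T : ℕ
  T = ∑[ a < L ] ∑[ c < a ] H a c
  Tₐ : ℕ → ℕ
  Tₐ a = ∑[ b < L ] ∑[ d < b ] h a b a d
  factor-2 : ∀ x y z → 2 * x + (2 * y + z) ≡ 2 * (x + y) + z
  factor-2 = solve-∀

sum-map-upTo : ∀ n (f : ℕ → ℕ) → sum (map f (upTo n)) ≡ ∑ n f
sum-map-upTo n f = sum-map-applyUpTo n id
  where
  sum-map-applyUpTo : ∀ n (g : ℕ → ℕ) → sum (map f (applyUpTo g n)) ≡ ∑[ x < n ] f (g x)
  sum-map-applyUpTo zero    g = refl
  sum-map-applyUpTo (suc n) g = begin
    f (g 0) + sum (map f (applyUpTo (g ∘ suc) n)) ≡⟨ cong (f (g 0) +_) (sum-map-applyUpTo n (g ∘ suc)) ⟩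
    f (g 0) + ∑[ x < n ] f (g (suc x))            ≡⟨ ∑-unshift n ⟩
    ∑[ x < suc n ] f (g x)                         ∎
    where
    ∑-unshift : ∀ n → f (g 0) + ∑[ x < n ] f (g (suc x)) ≡ ∑[ x < suc n ] f (g x)
    ∑-unshift zero    = +-comm (f (g 0)) 0
    ∑-unshift (suc n) = trans (sym (+-assoc (f (g 0)) _ _)) (cong (_+ f (g (suc n))) (∑-unshift n))

δ : ℕ → ℕ → ℕ
δ m n with m ≟ n
... | yes _ = 1
... | no  _ = 0

δ-≡ : ∀ {m n} → m ≡ n → δ m n ≡ 1
δ-≡ {m} {n} m≡n with m ≟ n
... | yes _   = refl
... | no  m≢n = contradiction m≡n m≢n

δ-≢ : ∀ {m n} → m ≢ n → δ m n ≡ 0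
δ-≢ {m} {n} m≢n with m ≟ n
... | yes m≡n = contradiction m≡n m≢n
... | no  _   = refl

δ-> : ∀ {m n} → m > n → δ m n ≡ 0
δ-> m>n = δ-≢ λ m≡n → <-irrefl (sym m≡n) m>n

δ-resp-⇔ : ∀ {m n m′ n′} → (m ≡ n → m′ ≡ n′) → (m′ ≡ n′ → m ≡ n) → δ m n ≡ δ m′ n′
δ-resp-⇔ {m} {n} to from with m ≟ n
... | yes m≡n = sym (δ-≡ (to m≡n))
... | no  m≢n = sym (δ-≢ (m≢n ∘ from))

δ-comm : ∀ m n → δ m n ≡ δ n m
δ-comm m n = δ-resp-⇔ sym sym

δ-*-cong : ∀ m n k l → (m ≡ n → k ≡ l) → δ m n * k ≡ δ m n * l
δ-*-cong m n k l k≡l with m ≟ n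
... | yes m≡n = cong (_+ 0) (k≡l m≡n)
... | no  _   = refl

-- Splitting an overpartition by its number of distinct part sizes

shift : ℕ → (ℕ → ℕ) → ℕ → ℕ
shift u F n = if u ≤ᵇ n then F (n ∸ u) else 0

shift-≤ : ∀ {u n} (F : ℕ → ℕ) → u ≤ n → shift u F n ≡ F (n ∸ u)
shift-≤ {u} {n} F u≤n with u ≤ᵇ n | ≤ᵇ-reflects-≤ u n
... | true  | _       = refl
... | false | ofⁿ u≰n = contradiction u≤n u≰n

shift-> : ∀ {u n} (F : ℕ → ℕ) → u > n → shift u F n ≡ 0
shift-> {u} {n} F u>n with u ≤ᵇ n | ≤ᵇ-reflects-≤ u n
... | true  | ofʸ u≤n = contradiction u≤n (<⇒≱ u>n)
... | false | _       = refl

shift-cong : ∀ u n {F G : ℕ → ℕ} → (∀ m → m ≤ n → F m ≡ G m) → shift u F n ≡ shift u G n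
shift-cong u n F≡G with u ≤ᵇ n
... | true  = F≡G (n ∸ u) (m∸n≤m n u)
... | false = refl

shift-+ : ∀ u n (F G : ℕ → ℕ) → shift u (λ m → F m + G m) n ≡ shift u F n + shift u G n
shift-+ u n F G with u ≤ᵇ n
... | true  = refl
... | false = refl

shift-* : ∀ u n k (F : ℕ → ℕ) → shift u (λ m → k * F m) n ≡ k * shift u F n
shift-* u n k F with u ≤ᵇ n
... | true  = refl
... | false = sym (*-zeroʳ k)

shift-∑ : ∀ u n k (F : ℕ → ℕ → ℕ) → shift u (λ m → ∑[ x < k ] F x m) n ≡ ∑[ x < k ] shift u (F x) n
shift-∑ u n k F with u ≤ᵇ n
... | true  = refl
... | false = sym (∑-≡0 k λ _ _ → refl)

shift-δ : ∀ u v n → shift u (δ v) n ≡ δ (u + v) n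
shift-δ u v n with u ≤? n
... | yes u≤n = trans (shift-≤ (δ v) u≤n) (δ-resp-⇔
                  (λ v≡n∸u → trans (cong (u +_) v≡n∸u) (m+[n∸m]≡n u≤n))
                  (λ u+v≡n → trans (sym (m+n∸m≡n u v)) (cong (_∸ u) u+v≡n)))
... | no  u≰n = trans (shift-> (δ v) (≰⇒> u≰n)) (sym (δ-> (≤-trans (≰⇒> u≰n) (m≤m+n u v))))

-- As in Defs, the index j stands for the part size 1 + j and c for the multiplicity 1 + c.
-- withPart F j n is the coefficient of qⁿ in F(q) · q^(1+j) / (1 − q^(1+j)).
withPart : (ℕ → ℕ) → ℕ → ℕ → ℕ
withPart F j n = ∑[ c < n ] shift (suc c * suc j) F n

withPart-cong : ∀ j n {F G : ℕ → ℕ} → (∀ m → F m ≡ G m) → withPart F j n ≡ withPart G j n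
withPart-cong j n F≡G = ∑-cong n λ c _ → shift-cong (suc c * suc j) n λ m _ → F≡G m

withPart-+ : ∀ j n (F G : ℕ → ℕ) → withPart (λ m → F m + G m) j n ≡ withPart F j n + withPart G j n
withPart-+ j n F G = trans (∑-cong n λ c _ → shift-+ (suc c * suc j) n F G) (∑-distrib-+ n _ _)

withPart-* : ∀ j n k (F : ℕ → ℕ) → withPart (λ m → k * F m) j n ≡ k * withPart F j n
withPart-* j n k F = trans (∑-cong n λ c _ → shift-* (suc c * suc j) n k F) (sym (*-distribˡ-∑ k n _))

allowed forbidden : ℕ → ℕ
allowed   i = if suc i % 3 ≡ᵇ 0 then 0 else 1
forbidden i = if suc i % 3 ≡ᵇ 0 then 1 else 0

allowed-or-forbidden : ∀ i → (allowed i ≡ 1 × forbidden i ≡ 0) ⊎ (allowed i ≡ 0 × forbidden i ≡ 1 × 3 ∣ suc i)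
allowed-or-forbidden i with suc i % 3 in eq
... | zero  = inj₂ (refl , refl , m%n≡0⇒n∣m (suc i) 3 eq)
... | suc _ = inj₁ (refl , refl)

forbidden-residue : ∀ j r → forbidden (j * 3 + r) ≡ forbidden r
forbidden-residue j r = cong (λ s → if s ≡ᵇ 0 then 1 else 0) (begin
  suc (j * 3 + r) % 3 ≡⟨ cong (λ k → suc k % 3) (+-comm (j * 3) r) ⟩
  (suc r + j * 3) % 3 ≡⟨ [m+kn]%n≡m%n (suc r) j 3 ⟩
  suc r % 3           ∎)

W-suc : ∀ j n → W (suc j) n ≡ W j n + allowed j * (2 * withPart (W j) j n)
W-suc j n with suc j % 3
... | zero  = sym (+-identityʳ (W j n))
... | suc _ = cong (W j n +_) (trans (cong (2 *_) (sum-map-upTo n _)) (sym (*-identityˡ _)))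

-- W₁ j and W₂ j count (with weight 1) the partitions into parts of size at most j with exactly
-- one, resp. two, distinct part sizes, none divisible by 3; W₃₊ j collects the rest, weighted by
-- 2^(d − 3) for d sizes.
W₁ W₂ W₃₊ : ℕ → ℕ → ℕ
W₁ j n = ∑[ i < j ] allowed i * withPart (λ m → δ m 0) i n
W₂ j n = ∑[ i < j ] allowed i * withPart (W₁ i) i n
W₃₊ zero    n = 0
W₃₊ (suc j) n = W₃₊ j n + allowed j * (withPart (W₂ j) j n + 2 * withPart (W₃₊ j) j n)

W-decomposition : ∀ j n → W j n ≡ δ n 0 + 2 * W₁ j n + 4 * W₂ j n + 8 * W₃₊ j n
W-decomposition zero    zero    = refl
W-decomposition zero    (suc n) = refl
W-decomposition (suc j) n = begin
  W (suc j) n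
    ≡⟨ W-suc j n ⟩
  W j n + a * (2 * withPart (W j) j n)
    ≡⟨ cong₂ (λ w p → w + a * (2 * p)) (W-decomposition j n) (withPart-cong j n (W-decomposition j)) ⟩
  parts n + a * (2 * withPart parts j n)
    ≡⟨ cong (λ p → parts n + a * (2 * p)) withPart-parts ⟩
  parts n + a * (2 * (P₀ + 2 * P₁ + 4 * P₂ + 8 * P₃))
    ≡⟨ regroup (δ n 0) (W₁ j n) (W₂ j n) (W₃₊ j n) a P₀ P₁ P₂ P₃ ⟩
  δ n 0 + 2 * W₁ (suc j) n + 4 * W₂ (suc j) n + 8 * W₃₊ (suc j) n ∎
  where
  parts : ℕ → ℕ
  parts m = δ m 0 + 2 * W₁ j m + 4 * W₂ j m + 8 * W₃₊ j m
  a P₀ P₁ P₂ P₃ : ℕ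
  a  = allowed j
  P₀ = withPart (λ m → δ m 0) j n
  P₁ = withPart (W₁ j) j n
  P₂ = withPart (W₂ j) j n
  P₃ = withPart (W₃₊ j) j n
  withPart-parts : withPart parts j n ≡ P₀ + 2 * P₁ + 4 * P₂ + 8 * P₃
  withPart-parts = begin
    withPart parts j n
      ≡⟨ withPart-+ j n (λ m → δ m 0 + 2 * W₁ j m + 4 * W₂ j m) (λ m → 8 * W₃₊ j m) ⟩
    withPart (λ m → δ m 0 + 2 * W₁ j m + 4 * W₂ j m) j n + withPart (λ m → 8 * W₃₊ j m) j n
      ≡⟨ cong₂ _+_ (withPart-+ j n (λ m → δ m 0 + 2 * W₁ j m) (λ m → 4 * W₂ j m))
                   (withPart-* j n 8 (W₃₊ j)) ⟩
    withPart (λ m → δ m 0 + 2 * W₁ j m) j n + withPart (λ m → 4 * W₂ j m) j n + 8 * P₃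
      ≡⟨ cong₂ (λ x y → x + y + 8 * P₃) (withPart-+ j n (λ m → δ m 0) (λ m → 2 * W₁ j m))
                                         (withPart-* j n 4 (W₂ j)) ⟩
    P₀ + withPart (λ m → 2 * W₁ j m) j n + 4 * P₂ + 8 * P₃
      ≡⟨ cong (λ x → P₀ + x + 4 * P₂ + 8 * P₃) (withPart-* j n 2 (W₁ j)) ⟩
    P₀ + 2 * P₁ + 4 * P₂ + 8 * P₃ ∎
  regroup : ∀ d w₁ w₂ w₃ a p₀ p₁ p₂ p₃ →
            d + 2 * w₁ + 4 * w₂ + 8 * w₃ + a * (2 * (p₀ + 2 * p₁ + 4 * p₂ + 8 * p₃)) ≡
            d + 2 * (w₁ + a * p₀) + 4 * (w₂ + a * p₁) + 8 * (w₃ + a * (p₂ + 2 * p₃))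
  regroup = solve-∀

withPart-δ₀ : ∀ j {n L} → n ≤ L → withPart (λ m → δ m 0) j n ≡ ∑[ c < L ] δ (suc c * suc j) n
withPart-δ₀ j {n} {L} n≤L = begin
  ∑[ c < n ] shift (suc c * suc j) (λ m → δ m 0) n
    ≡⟨ ∑-cong n (λ c _ → shift-δ₀ (suc c * suc j)) ⟩
  ∑[ c < n ] δ (suc c * suc j) n
    ≡⟨ ∑-truncate _ n≤L (λ c n≤c → δ-> (≤-trans (s≤s n≤c) (m≤m*n (suc c) (suc j)))) ⟨
  ∑[ c < L ] δ (suc c * suc j) n ∎
  where
  shift-δ₀ : ∀ u → shift u (λ m → δ m 0) n ≡ δ u n
  shift-δ₀ u = begin
    shift u (λ m → δ m 0) n ≡⟨ shift-cong u n (λ m _ → δ-comm m 0) ⟩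
    shift u (δ 0) n         ≡⟨ shift-δ u 0 n ⟩
    δ (u + 0) n             ≡⟨ cong (λ v → δ v n) (+-identityʳ u) ⟩
    δ u n                   ∎

W₁-closed : ∀ j {n L} → n ≤ L → W₁ j n ≡ ∑[ i < j ] allowed i * (∑[ c < L ] δ (suc c * suc i) n)
W₁-closed j n≤L = ∑-cong j λ i _ → cong (allowed i *_) (withPart-δ₀ i n≤L)

twoSizes : ℕ → ℕ → ℕ → ℕ
twoSizes n i i′ = ∑[ c < n ] ∑[ c′ < n ] δ (suc c * suc i + suc c′ * suc i′) n

withPart-W₁ : ∀ i n → withPart (W₁ i) i n ≡ ∑[ i′ < i ] allowed i′ * twoSizes n i i′
withPart-W₁ i n = begin
  ∑[ c < n ] shift (suc c * suc i) (W₁ i) n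
    ≡⟨ ∑-cong n (λ c _ → shift-cong (suc c * suc i) n λ m m≤n → W₁-closed i m≤n) ⟩
  ∑[ c < n ] shift (suc c * suc i) (λ m → ∑[ i′ < i ] allowed i′ * (∑[ c′ < n ] δ (suc c′ * suc i′) m)) n
    ≡⟨ ∑-cong n (λ c _ → shift-W₁ (suc c * suc i)) ⟩
  ∑[ c < n ] ∑[ i′ < i ] allowed i′ * (∑[ c′ < n ] δ (suc c * suc i + suc c′ * suc i′) n)
    ≡⟨ ∑-comm n i _ ⟩
  ∑[ i′ < i ] ∑[ c < n ] allowed i′ * (∑[ c′ < n ] δ (suc c * suc i + suc c′ * suc i′) n)
    ≡⟨ ∑-cong i (λ i′ _ → *-distribˡ-∑ (allowed i′) n _) ⟨
  ∑[ i′ < i ] allowed i′ * twoSizes n i i′ ∎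
  where
  shift-W₁ : ∀ u → shift u (λ m → ∑[ i′ < i ] allowed i′ * (∑[ c′ < n ] δ (suc c′ * suc i′) m)) n ≡
                   ∑[ i′ < i ] allowed i′ * (∑[ c′ < n ] δ (u + suc c′ * suc i′) n)
  shift-W₁ u = begin
    shift u (λ m → ∑[ i′ < i ] allowed i′ * (∑[ c′ < n ] δ (suc c′ * suc i′) m)) n
      ≡⟨ shift-∑ u n i (λ i′ m → allowed i′ * (∑[ c′ < n ] δ (suc c′ * suc i′) m)) ⟩
    ∑[ i′ < i ] shift u (λ m → allowed i′ * (∑[ c′ < n ] δ (suc c′ * suc i′) m)) n
      ≡⟨ ∑-cong i (λ i′ _ → shift-* u n (allowed i′) λ m → ∑[ c′ < n ] δ (suc c′ * suc i′) m) ⟩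
    ∑[ i′ < i ] allowed i′ * shift u (λ m → ∑[ c′ < n ] δ (suc c′ * suc i′) m) n
      ≡⟨ ∑-cong i (λ i′ _ → cong (allowed i′ *_) (trans (shift-∑ u n n λ c′ → δ (suc c′ * suc i′))
                                                         (∑-cong n λ c′ _ → shift-δ u (suc c′ * suc i′) n))) ⟩
    ∑[ i′ < i ] allowed i′ * (∑[ c′ < n ] δ (u + suc c′ * suc i′) n) ∎

W₂-closed : ∀ j n → W₂ j n ≡ ∑[ i < j ] ∑[ i′ < i ] allowed i * (allowed i′ * twoSizes n i i′)
W₂-closed j n = ∑-cong j λ i _ → trans (cong (allowed i *_) (withPart-W₁ i n)) (*-distribˡ-∑ (allowed i) i _)

-- Factorizations and partitions into two part sizes

twoSizes-comm : ∀ n i i′ → twoSizes n i i′ ≡ twoSizes n i′ i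
twoSizes-comm n i i′ = trans (∑-comm n n _) (∑-cong n λ c′ _ → ∑-cong n λ c _ →
  cong (λ s → δ s n) (+-comm (suc c * suc i) (suc c′ * suc i′)))

twoSizes-≥ : ∀ n i i′ → n ≤ i → twoSizes n i i′ ≡ 0
twoSizes-≥ n i i′ n≤i = ∑-≡0 n λ c _ → ∑-≡0 n λ c′ _ →
  δ-> (<-≤-trans (s≤s n≤i) (≤-trans (m≤n*m (suc i) (suc c)) (m≤m+n (suc c * suc i) (suc c′ * suc i′))))

twoSizes-3∣ : ∀ {n} i i′ → ¬ 3 ∣ n → 3 ∣ suc i → 3 ∣ suc i′ → twoSizes n i i′ ≡ 0
twoSizes-3∣ {n} i i′ 3∤n 3∣i 3∣i′ = ∑-≡0 n λ c _ → ∑-≡0 n λ c′ _ →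
  δ-≢ λ eq → 3∤n (subst (3 ∣_) eq (∣m∣n⇒∣m+n (∣n⇒∣m*n (suc c) 3∣i) (∣n⇒∣m*n (suc c′) 3∣i′)))

∑-forbidden : ∀ n (H : ℕ → ℕ) → (∀ i → n ≤ i → H i ≡ 0) →
              ∑[ i < n ] forbidden i * H i ≡ ∑[ j < n ] H (j * 3 + 2)
∑-forbidden n H H≡0 = begin
  ∑[ i < n ] forbidden i * H i
    ≡⟨ ∑-truncate _ (m≤m*n n 3) (λ i n≤i → trans (cong (forbidden i *_) (H≡0 i n≤i)) (*-zeroʳ (forbidden i))) ⟨
  ∑[ i < n * 3 ] forbidden i * H i
    ≡⟨ ∑-blocks 3 n _ ⟩
  ∑[ j < n ] ∑[ r < 3 ] forbidden (j * 3 + r) * H (j * 3 + r)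
    ≡⟨ ∑-cong n (λ j _ → only-last-residue j) ⟩
  ∑[ j < n ] H (j * 3 + 2) ∎
  where
  only-last-residue : ∀ j → ∑[ r < 3 ] forbidden (j * 3 + r) * H (j * 3 + r) ≡ H (j * 3 + 2)
  only-last-residue j rewrite forbidden-residue j 0 | forbidden-residue j 1 | forbidden-residue j 2 = +-identityʳ _

toℕ : Parity → ℕ
toℕ 0ℙ = 0
toℕ 1ℙ = 1

toℕ-parity-suc : ∀ k → toℕ (parity k) + toℕ (parity (suc k)) ≡ 1
toℕ-parity-suc zero          = refl
toℕ-parity-suc (suc zero)    = refl
toℕ-parity-suc (suc (suc k)) = toℕ-parity-suc k

parity-even : ∀ k → parity (k * 2) ≡ 0ℙ
parity-even zero    = refl
parity-even (suc k) = parity-even k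

parity-odd : ∀ k → parity (1 + k * 2) ≡ 1ℙ
parity-odd zero    = refl
parity-odd (suc k) = parity-odd k

parity-+-of-even-* : ∀ x y → parity (x * y) ≡ 0ℙ → toℕ (parity (x + y)) ≡ toℕ (parity x) + toℕ (parity y)
parity-+-of-even-* x y xy-even rewrite ℙ.+-homo-+ x y | ℙ.*-homo-* x y with parity x | parity y
... | 0ℙ | 0ℙ = refl
... | 0ℙ | 1ℙ = refl
... | 1ℙ | 0ℙ = refl
... | 1ℙ | 1ℙ = contradiction xy-even λ ()

parity-factors-of-odd : ∀ x y → parity (x * y) ≡ 1ℙ → parity x ≡ 1ℙ × parity y ≡ 1ℙ
parity-factors-of-odd x y xy-odd rewrite ℙ.*-homo-* x y with parity x | parity y
... | 1ℙ | 1ℙ = refl , refl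
... | 0ℙ | _  = contradiction xy-odd λ ()
... | 1ℙ | 0ℙ = contradiction xy-odd λ ()

parity-+-of-odd-* : ∀ x y → parity (x * y) ≡ 1ℙ → parity (x + y) ≡ 0ℙ
parity-+-of-odd-* x y xy-odd with parity-factors-of-odd x y xy-odd
... | x-odd , y-odd = trans (ℙ.+-homo-+ x y) (cong₂ ℙ._+_ x-odd y-odd)

parity-gap : ∀ a b → parity (a + b) ≡ parity (suc b + suc a)
parity-gap a b = cong parity (sym (+-suc-suc a b))
  where
  +-suc-suc : ∀ a b → suc b + suc a ≡ 2 + (a + b)
  +-suc-suc = solve-∀

factorPairs increasingFactorPairs : ℕ → ℕ → ℕ
factorPairs           L n = ∑[ a < L ] ∑[ b < L ] δ (suc b * suc a) n
increasingFactorPairs L n = ∑[ a < L ] ∑[ b < a ] δ (suc b * suc a) n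

factorPairs-nonsquare : ∀ L n → (∀ x → x * x ≢ n) → factorPairs L n ≡ 2 * increasingFactorPairs L n
factorPairs-nonsquare L n n≢x² = begin
  factorPairs L n
    ≡⟨ ∑²-symmetric L (λ a b → δ (suc b * suc a) n) (λ a b → cong (λ s → δ s n) (*-comm (suc b) (suc a))) ⟩
  2 * increasingFactorPairs L n + ∑[ a < L ] δ (suc a * suc a) n
    ≡⟨ cong (2 * increasingFactorPairs L n +_) (∑-≡0 L λ a _ → δ-≢ (n≢x² (suc a))) ⟩
  2 * increasingFactorPairs L n + 0
    ≡⟨ +-identityʳ _ ⟩
  2 * increasingFactorPairs L n ∎

oddGapPairs evenGapPairs : ℕ → ℕ
oddGapPairs  n = ∑[ a < n ] ∑[ b < a ] δ (suc b * suc a) n * toℕ (parity (a + b))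
evenGapPairs n = ∑[ a < n ] ∑[ b < a ] δ (suc b * suc a) n * toℕ (parity (suc (a + b)))

increasingFactorPairs-split : ∀ n → increasingFactorPairs n n ≡ oddGapPairs n + evenGapPairs n
increasingFactorPairs-split n = begin
  ∑[ a < n ] ∑[ b < a ] d a b
    ≡⟨ ∑-cong n (λ a _ → ∑-cong a λ b _ → by-parity a b) ⟩
  ∑[ a < n ] ∑[ b < a ] (d a b * odd-gap a b + d a b * even-gap a b)
    ≡⟨ ∑-cong n (λ a _ → ∑-distrib-+ a _ _) ⟩
  ∑[ a < n ] (∑[ b < a ] d a b * odd-gap a b + ∑[ b < a ] d a b * even-gap a b)
    ≡⟨ ∑-distrib-+ n _ _ ⟩
  oddGapPairs n + evenGapPairs n ∎
  where
  d odd-gap even-gap : ℕ → ℕ → ℕ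
  d        a b = δ (suc b * suc a) n
  odd-gap  a b = toℕ (parity (a + b))
  even-gap a b = toℕ (parity (suc (a + b)))
  by-parity : ∀ a b → d a b ≡ d a b * odd-gap a b + d a b * even-gap a b
  by-parity a b = begin
    d a b                                      ≡⟨ *-identityʳ (d a b) ⟨
    d a b * 1                                  ≡⟨ cong (d a b *_) (toℕ-parity-suc (a + b)) ⟨
    d a b * (odd-gap a b + even-gap a b)       ≡⟨ *-distribˡ-+ (d a b) (odd-gap a b) (even-gap a b) ⟩
    d a b * odd-gap a b + d a b * even-gap a b ∎

evenGapPairs-diagonal : ∀ n → evenGapPairs n ≡ ∑[ a < n ] ∑[ b < n ] δ (suc a * suc (suc a + b) + suc b * suc a) n
evenGapPairs-diagonal n = begin
  evenGapPairs n
    ≡⟨ ∑-triangle n g (λ a b n≤a → cong (_* toℕ (parity (suc (a + b))))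
                                        (δ-> (<-≤-trans (s≤s n≤a) (m≤n*m (suc a) (suc b))))) ⟩
  ∑[ b < n ] ∑[ d < n ] g (suc b + d) b
    ≡⟨ ∑-cong n (λ b _ → ∑-truncate _ (m≤m*n n 2) λ d n≤d → cong (_* toℕ (parity (suc (suc b + d + b))))
         (δ-> (<-≤-trans (s≤s (≤-trans n≤d (m≤n+m d (suc b)))) (m≤n*m (suc (suc b + d)) (suc b))))) ⟨
  ∑[ b < n ] ∑[ d < n * 2 ] g (suc b + d) b
    ≡⟨ ∑-cong n (λ b _ → ∑-even-odd n λ d → g (suc b + d) b) ⟩
  ∑[ b < n ] (∑[ e < n ] g (suc b + e * 2) b + ∑[ e < n ] g (suc b + (e * 2 + 1)) b)
    ≡⟨ ∑-cong n (λ b _ → cong₂ _+_ (∑-≡0 n λ e _ → odd-gap b e) (∑-cong n λ e _ → even-gap b e)) ⟩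
  ∑[ a < n ] ∑[ b < n ] δ (suc a * suc (suc a + b) + suc b * suc a) n ∎
  where
  g : ℕ → ℕ → ℕ
  g a b = δ (suc b * suc a) n * toℕ (parity (suc (a + b)))
  odd-gap : ∀ b e → g (suc b + e * 2) b ≡ 0
  odd-gap b e = trans (cong (λ p → δ (suc b * suc (suc b + e * 2)) n * toℕ p)
                            (trans (cong parity (rearrange b e)) (parity-even (1 + b + e))))
                      (*-zeroʳ (δ (suc b * suc (suc b + e * 2)) n))
    where
    rearrange : ∀ b e → suc (suc b + e * 2 + b) ≡ (1 + b + e) * 2
    rearrange = solve-∀
  even-gap : ∀ b e → g (suc b + (e * 2 + 1)) b ≡ δ (suc b * suc (suc b + e) + suc e * suc b) n
  even-gap b e = trans (cong₂ (λ k p → δ k n * toℕ p) (factor b e)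
                              (trans (cong parity (rearrange b e)) (parity-odd (1 + b + e))))
                       (*-identityʳ (δ (suc b * suc (suc b + e) + suc e * suc b) n))
    where
    factor : ∀ b e → suc b * suc (suc b + (e * 2 + 1)) ≡ suc b * suc (suc b + e) + suc e * suc b
    factor = solve-∀
    rearrange : ∀ b e → suc (suc b + (e * 2 + 1) + b) ≡ 1 + (1 + b + e) * 2
    rearrange = solve-∀

twoSizePartitions mixedTwoSizePartitions : ℕ → ℕ
twoSizePartitions      n = ∑[ i < n ] ∑[ i′ < i ] twoSizes n i i′
mixedTwoSizePartitions n = ∑[ i < n ] ∑[ i′ < n ] forbidden i * twoSizes n i i′

-- With s = 1 + a, t = 1 + b, u = 1 + c, v = 1 + d, the summand counts n = u (s + t) + v s, which
-- also equals s (u + v) + t u; so the swap (a, b, c, d) ↦ (c, d, a, b) exchanges (s, t) and (u, v).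
twoSizePartitions-parity : ∀ n → 2 ∣ twoSizePartitions n + evenGapPairs n
twoSizePartitions-parity n = let u , ∑⁴h≡ = ∑⁴-pair-swap n h h-swap in divides (u + evenGapPairs n) (begin
  twoSizePartitions n + evenGapPairs n
    ≡⟨ cong (_+ evenGapPairs n) (∑-triangle n (twoSizes n) (twoSizes-≥ n)) ⟩
  ∑[ a < n ] ∑[ b < n ] ∑[ c < n ] ∑[ d < n ] h a b c d + evenGapPairs n
    ≡⟨ cong (_+ evenGapPairs n) ∑⁴h≡ ⟩
  2 * u + ∑[ a < n ] ∑[ b < n ] h a b a b + evenGapPairs n
    ≡⟨ cong (λ d → 2 * u + d + evenGapPairs n) (evenGapPairs-diagonal n) ⟨
  2 * u + evenGapPairs n + evenGapPairs n
    ≡⟨ double u (evenGapPairs n) ⟩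
  (u + evenGapPairs n) * 2 ∎)
  where
  h : ℕ → ℕ → ℕ → ℕ → ℕ
  h a b c d = δ (suc c * suc (suc a + b) + suc d * suc a) n
  h-swap : ∀ a b c d → h a b c d ≡ h c d a b
  h-swap a b c d = cong (λ s → δ s n) (swap-pairs a b c d)
    where
    swap-pairs : ∀ a b c d → suc c * suc (suc a + b) + suc d * suc a ≡ suc a * suc (suc c + d) + suc b * suc c
    swap-pairs = solve-∀
  double : ∀ u d → 2 * u + d + d ≡ (u + d) * 2
  double = solve-∀

unit-weight : ∀ a a′ f f′ t → a * a′ + (f + f′) ≡ 1 → t ≡ a * (a′ * t) + (f + f′) * t
unit-weight a a′ f f′ t weights≡1 = begin
  t                           ≡⟨ *-identityˡ t ⟨
  1 * t                       ≡⟨ cong (_* t) weights≡1 ⟨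
  (a * a′ + (f + f′)) * t     ≡⟨ distribute a a′ f f′ t ⟩
  a * (a′ * t) + (f + f′) * t ∎
  where
  distribute : ∀ a a′ f f′ t → (a * a′ + (f + f′)) * t ≡ a * (a′ * t) + (f + f′) * t
  distribute = solve-∀

module _ {N : ℕ} (3∤N : ¬ 3 ∣ N) (N≢x²+3y² : ∀ x y → x * x + 3 * (y * y) ≢ N) where

  W₁-gaps : W₁ N N ≡ 2 * (oddGapPairs N + evenGapPairs N)
  W₁-gaps = begin
    W₁ N N
      ≡⟨ W₁-closed N {N} ≤-refl ⟩
    ∑[ i < N ] allowed i * (∑[ c < N ] δ (suc c * suc i) N)
      ≡⟨ ∑-cong N (λ i _ → *-distribˡ-∑ (allowed i) N _) ⟩
    ∑[ i < N ] ∑[ c < N ] allowed i * δ (suc c * suc i) N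
      ≡⟨ ∑-cong N (λ i _ → ∑-cong N λ c _ → allowed-divisor i c) ⟩
    factorPairs N N
      ≡⟨ factorPairs-nonsquare N N N≢x² ⟩
    2 * increasingFactorPairs N N
      ≡⟨ cong (2 *_) (increasingFactorPairs-split N) ⟩
    2 * (oddGapPairs N + evenGapPairs N) ∎
    where
    allowed-divisor : ∀ i c → allowed i * δ (suc c * suc i) N ≡ δ (suc c * suc i) N
    allowed-divisor i c with allowed-or-forbidden i
    ... | inj₁ (a≡1 , _)       = trans (cong (_* δ (suc c * suc i) N) a≡1) (*-identityˡ _)
    ... | inj₂ (a≡0 , _ , 3∣i) = trans (cong (_* δ (suc c * suc i) N) a≡0)
                                       (sym (δ-≢ λ eq → 3∤N (subst (3 ∣_) eq (∣n⇒∣m*n (suc c) 3∣i))))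
    N≢x² : ∀ x → x * x ≢ N
    N≢x² x = N≢x²+3y² x 0 ∘ trans (+-identityʳ (x * x))

  twoSizes-by-divisibility : ∀ i i′ → twoSizes N i i′ ≡
    allowed i * (allowed i′ * twoSizes N i i′) + (forbidden i + forbidden i′) * twoSizes N i i′
  twoSizes-by-divisibility i i′ with allowed-or-forbidden i | allowed-or-forbidden i′
  ... | inj₁ (a≡1 , f≡0) | inj₁ (a′≡1 , f′≡0) =
    unit-weight (allowed i) (allowed i′) (forbidden i) (forbidden i′) (twoSizes N i i′)
                (cong₂ _+_ (cong₂ _*_ a≡1 a′≡1) (cong₂ _+_ f≡0 f′≡0))
  ... | inj₁ (a≡1 , f≡0) | inj₂ (a′≡0 , f′≡1 , _) =
    unit-weight (allowed i) (allowed i′) (forbidden i) (forbidden i′) (twoSizes N i i′)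
                (cong₂ _+_ (cong₂ _*_ a≡1 a′≡0) (cong₂ _+_ f≡0 f′≡1))
  ... | inj₂ (a≡0 , f≡1 , _) | inj₁ (a′≡1 , f′≡0) =
    unit-weight (allowed i) (allowed i′) (forbidden i) (forbidden i′) (twoSizes N i i′)
                (cong₂ _+_ (cong₂ _*_ a≡0 a′≡1) (cong₂ _+_ f≡1 f′≡0))
  ... | inj₂ (_ , _ , 3∣i) | inj₂ (_ , _ , 3∣i′) rewrite twoSizes-3∣ i i′ 3∤N 3∣i 3∣i′ =
    sym (cong₂ _+_ (trans (cong (allowed i *_) (*-zeroʳ (allowed i′))) (*-zeroʳ (allowed i)))
                   (*-zeroʳ (forbidden i + forbidden i′)))

  twoSizePartitions-split : twoSizePartitions N ≡ W₂ N N + mixedTwoSizePartitions N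
  twoSizePartitions-split = begin
    ∑[ i < N ] ∑[ i′ < i ] T i i′
      ≡⟨ ∑-cong N (λ i _ → ∑-cong i λ i′ _ → twoSizes-by-divisibility i i′) ⟩
    ∑[ i < N ] ∑[ i′ < i ] (allowed i * (allowed i′ * T i i′) + (forbidden i + forbidden i′) * T i i′)
      ≡⟨ ∑-cong N (λ i _ → ∑-distrib-+ i _ _) ⟩
    ∑[ i < N ] (∑[ i′ < i ] allowed i * (allowed i′ * T i i′) + ∑[ i′ < i ] (forbidden i + forbidden i′) * T i i′)
      ≡⟨ ∑-distrib-+ N _ _ ⟩
    ∑[ i < N ] ∑[ i′ < i ] allowed i * (allowed i′ * T i i′)
      + ∑[ i < N ] ∑[ i′ < i ] (forbidden i + forbidden i′) * T i i′
      ≡⟨ cong₂ _+_ (sym (W₂-closed N N))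
                   (∑-cong N λ i _ → trans (∑-cong i λ i′ _ → split-weight i i′) (∑-distrib-+ i _ _)) ⟩
    W₂ N N + ∑[ i < N ] (∑[ i′ < i ] g i i′ + ∑[ i′ < i ] g i′ i)
      ≡⟨ cong (W₂ N N +_) (∑-distrib-+ N _ _) ⟩
    W₂ N N + (∑[ i < N ] ∑[ i′ < i ] g i i′ + ∑[ i < N ] ∑[ i′ < i ] g i′ i)
      ≡⟨ cong (W₂ N N +_) (+-identityʳ _) ⟨
    W₂ N N + (∑[ i < N ] ∑[ i′ < i ] g i i′ + ∑[ i < N ] ∑[ i′ < i ] g i′ i + 0)
      ≡⟨ cong (λ d → W₂ N N + (∑[ i < N ] ∑[ i′ < i ] g i i′ + ∑[ i < N ] ∑[ i′ < i ] g i′ i + d))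
              (∑-≡0 N λ i _ → forbidden-diagonal i) ⟨
    W₂ N N + (∑[ i < N ] ∑[ i′ < i ] g i i′ + ∑[ i < N ] ∑[ i′ < i ] g i′ i + ∑[ i < N ] g i i)
      ≡⟨ cong (W₂ N N +_) (∑²-split N g) ⟨
    W₂ N N + mixedTwoSizePartitions N ∎
    where
    T : ℕ → ℕ → ℕ
    T = twoSizes N
    g : ℕ → ℕ → ℕ
    g i i′ = forbidden i * T i i′
    split-weight : ∀ i i′ → (forbidden i + forbidden i′) * T i i′ ≡ g i i′ + g i′ i
    split-weight i i′ = trans (*-distribʳ-+ (T i i′) (forbidden i) (forbidden i′))
                              (cong (g i i′ +_) (cong (forbidden i′ *_) (twoSizes-comm N i i′)))
    forbidden-diagonal : ∀ i → g i i ≡ 0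
    forbidden-diagonal i with allowed-or-forbidden i
    ... | inj₁ (_ , f≡0)     = cong (_* T i i) f≡0
    ... | inj₂ (_ , _ , 3∣i) = trans (cong (forbidden i *_) (twoSizes-3∣ i i 3∤N 3∣i 3∣i)) (*-zeroʳ (forbidden i))

  -- A part size 3(1 + j) with multiplicity 1 + c can trade j and c, and likewise the other size
  -- i′ with its multiplicity c′; a partition fixed by both would give N = (1 + i′)² + 3 (1 + j)².
  mixedTwoSizePartitions-even : 2 ∣ mixedTwoSizePartitions N
  mixedTwoSizePartitions-even = let u , ∑⁴h≡ = ∑⁴-pair-swap N h h-swap in divides u (begin
    ∑[ i < N ] ∑[ i′ < N ] forbidden i * twoSizes N i i′
      ≡⟨ ∑-cong N (λ i _ → *-distribˡ-∑ (forbidden i) N (twoSizes N i)) ⟨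
    ∑[ i < N ] forbidden i * (∑[ i′ < N ] twoSizes N i i′)
      ≡⟨ ∑-forbidden N (λ i → ∑[ i′ < N ] twoSizes N i i′)
                       (λ i N≤i → ∑-≡0 N λ i′ _ → twoSizes-≥ N i i′ N≤i) ⟩
    ∑[ j < N ] ∑[ i′ < N ] ∑[ c < N ] ∑[ c′ < N ] h j i′ c c′
      ≡⟨ ∑⁴h≡ ⟩
    2 * u + ∑[ j < N ] ∑[ i′ < N ] h j i′ j i′
      ≡⟨ cong (2 * u +_) (∑-≡0 N λ j _ → ∑-≡0 N λ i′ _ →
                             δ-≢ (N≢x²+3y² (suc i′) (suc j) ∘ trans (diagonal j i′))) ⟩
    2 * u + 0
      ≡⟨ trans (+-identityʳ (2 * u)) (*-comm 2 u) ⟩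
    u * 2 ∎)
    where
    h : ℕ → ℕ → ℕ → ℕ → ℕ
    h j i′ c c′ = δ (suc c * suc (j * 3 + 2) + suc c′ * suc i′) N
    h-swap : ∀ j i′ c c′ → h j i′ c c′ ≡ h c c′ j i′
    h-swap j i′ c c′ = cong (λ s → δ s N) (swap-pairs j i′ c c′)
      where
      swap-pairs : ∀ j i′ c c′ →
                   suc c * suc (j * 3 + 2) + suc c′ * suc i′ ≡ suc j * suc (c * 3 + 2) + suc i′ * suc c′
      swap-pairs = solve-∀
    diagonal : ∀ j i′ → suc i′ * suc i′ + 3 * (suc j * suc j) ≡ suc j * suc (j * 3 + 2) + suc i′ * suc i′
    diagonal = solve-∀

  W₂≡evenGapPairs-mod-2 : 2 ∣ W₂ N N + evenGapPairs N
  W₂≡evenGapPairs-mod-2 = ∣m+n∣m⇒∣n (subst (2 ∣_) rearrange (twoSizePartitions-parity N)) mixedTwoSizePartitions-even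
    where
    rearrange : twoSizePartitions N + evenGapPairs N ≡ mixedTwoSizePartitions N + (W₂ N N + evenGapPairs N)
    rearrange = trans (cong (_+ evenGapPairs N) twoSizePartitions-split)
                      (rotate (W₂ N N) (mixedTwoSizePartitions N) (evenGapPairs N))
      where
      rotate : ∀ w b d → w + b + d ≡ b + (w + d)
      rotate = solve-∀

  8∣W-from-2∣oddGapPairs : 2 ∣ oddGapPairs N → 8 ∣ W N N
  8∣W-from-2∣oddGapPairs 2∣Y =
    subst (8 ∣_) (sym W≡) (∣m∣n⇒∣m+n (*-monoʳ-∣ 4 2∣Y+W₂+D) (m∣m*n (W₃₊ N N)))
    where
    2∣Y+W₂+D : 2 ∣ oddGapPairs N + (W₂ N N + evenGapPairs N)
    2∣Y+W₂+D = ∣m∣n⇒∣m+n 2∣Y W₂≡evenGapPairs-mod-2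
    W≡ : W N N ≡ 4 * (oddGapPairs N + (W₂ N N + evenGapPairs N)) + 8 * W₃₊ N N
    W≡ = begin
      W N N
        ≡⟨ W-decomposition N N ⟩
      δ N 0 + 2 * W₁ N N + 4 * W₂ N N + 8 * W₃₊ N N
        ≡⟨ cong₂ (λ d w → d + 2 * w + 4 * W₂ N N + 8 * W₃₊ N N) (δ-≢ (≢-sym (N≢x²+3y² 0 0))) W₁-gaps ⟩
      0 + 2 * (2 * (oddGapPairs N + evenGapPairs N)) + 4 * W₂ N N + 8 * W₃₊ N N
        ≡⟨ regroup (oddGapPairs N) (evenGapPairs N) (W₂ N N) (W₃₊ N N) ⟩
      4 * (oddGapPairs N + (W₂ N N + evenGapPairs N)) + 8 * W₃₊ N N ∎
      where
      regroup : ∀ y d w₂ w₃ → 0 + 2 * (2 * (y + d)) + 4 * w₂ + 8 * w₃ ≡ 4 * (y + (w₂ + d)) + 8 * w₃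
      regroup = solve-∀

-- Factorizations with odd gap

2^[1+k]*m≡2^k*m*2 : ∀ k m → 2 ^ suc k * m ≡ 2 ^ k * m * 2
2^[1+k]*m≡2^k*m*2 k m = double-last (2 ^ k) m
  where
  double-last : ∀ p m → 2 * p * m ≡ p * m * 2
  double-last = solve-∀

oddGapPairs-odd : ∀ n → parity n ≡ 1ℙ → oddGapPairs n ≡ 0
oddGapPairs-odd n n-odd = ∑-≡0 n λ a _ → ∑-≡0 a λ b _ →
  trans (δ-*-cong (suc b * suc a) n (toℕ (parity (a + b))) 0 λ ≡n →
           cong toℕ (trans (parity-gap a b) (parity-+-of-odd-* (suc b) (suc a) (trans (cong parity ≡n) n-odd))))
        (*-zeroʳ (δ (suc b * suc a) n))

oddFactorPairs : ℕ → ℕ → ℕ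
oddFactorPairs L n = ∑[ a < L ] ∑[ b < L ] δ (suc b * suc a) n * toℕ (parity (suc a))

-- For even n, a factorization n = x y with x − y odd has exactly one odd factor, so the ordered
-- such factorizations, 2 · oddGapPairs n in number, are those with x odd plus those with y odd.
oddGapPairs≡oddFactorPairs : ∀ n → parity n ≡ 0ℙ → oddGapPairs n ≡ oddFactorPairs n n
oddGapPairs≡oddFactorPairs n n-even = *-cancelˡ-≡ _ _ 2 (begin
  2 * oddGapPairs n
    ≡⟨ +-identityʳ _ ⟨
  2 * oddGapPairs n + 0
    ≡⟨ cong (2 * oddGapPairs n +_) (∑-≡0 n λ a _ → diagonal a) ⟨
  2 * oddGapPairs n + ∑[ a < n ] g a a
    ≡⟨ ∑²-symmetric n g g-sym ⟨
  ∑[ a < n ] ∑[ b < n ] g a b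
    ≡⟨ ∑-cong n (λ a _ → trans (∑-cong n λ b _ → odd-factor a b) (∑-distrib-+ n _ _)) ⟩
  ∑[ a < n ] (∑[ b < n ] δ (suc b * suc a) n * toℕ (parity (suc b))
              + ∑[ b < n ] δ (suc b * suc a) n * toℕ (parity (suc a)))
    ≡⟨ ∑-distrib-+ n _ _ ⟩
  ∑[ a < n ] ∑[ b < n ] δ (suc b * suc a) n * toℕ (parity (suc b)) + oddFactorPairs n n
    ≡⟨ cong (_+ oddFactorPairs n n) (trans (∑-comm n n _) (∑-cong n λ b _ → ∑-cong n λ a _ →
         cong (λ k → δ k n * toℕ (parity (suc b))) (*-comm (suc b) (suc a)))) ⟩
  oddFactorPairs n n + oddFactorPairs n n
    ≡⟨ cong (oddFactorPairs n n +_) (+-identityʳ _) ⟨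
  2 * oddFactorPairs n n ∎)
  where
  g : ℕ → ℕ → ℕ
  g a b = δ (suc b * suc a) n * toℕ (parity (a + b))
  g-sym : ∀ a b → g a b ≡ g b a
  g-sym a b = cong₂ (λ k l → δ k n * toℕ (parity l)) (*-comm (suc b) (suc a)) (+-comm a b)
  diagonal : ∀ a → g a a ≡ 0
  diagonal a = trans (cong (λ k → δ (suc a * suc a) n * toℕ (parity k)) (+-*-two a))
                     (trans (cong (λ p → δ (suc a * suc a) n * toℕ p) (parity-even a)) (*-zeroʳ (δ (suc a * suc a) n)))
    where
    +-*-two : ∀ a → a + a ≡ a * 2
    +-*-two = solve-∀
  odd-factor : ∀ a b → g a b ≡ δ (suc b * suc a) n * toℕ (parity (suc b))
                              + δ (suc b * suc a) n * toℕ (parity (suc a))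
  odd-factor a b = trans (δ-*-cong (suc b * suc a) n _ _ λ ≡n →
                           trans (cong toℕ (parity-gap a b))
                                 (parity-+-of-even-* (suc b) (suc a) (trans (cong parity ≡n) n-even)))
                         (*-distribˡ-+ (δ (suc b * suc a) n) _ _)

oddFactorPairs-double : ∀ {L} n → n * 2 ≤ L → oddFactorPairs L (n * 2) ≡ oddFactorPairs L n
oddFactorPairs-double {L} n n*2≤L = ∑-cong L λ a _ → begin
  ∑[ b < L ] F a b
    ≡⟨ ∑-truncate _ (m≤m*n L 2) (λ b L≤b → cong (_* toℕ (parity (suc a)))
                                  (δ-> (<-≤-trans (s≤s (≤-trans n*2≤L L≤b)) (m≤m*n (suc b) (suc a))))) ⟨
  ∑[ b < L * 2 ] F a b
    ≡⟨ ∑-even-odd L (F a) ⟩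
  ∑[ e < L ] F a (e * 2) + ∑[ e < L ] F a (e * 2 + 1)
    ≡⟨ cong₂ _+_ (∑-≡0 L λ e _ → odd-cofactor a e) (∑-cong L λ e _ → even-cofactor a e) ⟩
  ∑[ e < L ] δ (suc e * suc a) n * toℕ (parity (suc a)) ∎
  where
  F : ℕ → ℕ → ℕ
  F a b = δ (suc b * suc a) (n * 2) * toℕ (parity (suc a))
  odd-cofactor : ∀ a e → F a (e * 2) ≡ 0
  odd-cofactor a e = trans (δ-*-cong (suc (e * 2) * suc a) (n * 2) _ 0 λ ≡n*2 → cong toℕ (begin
      parity (suc a)                          ≡⟨⟩
      1ℙ ℙ.* parity (suc a)                   ≡⟨ cong (ℙ._* parity (suc a)) (parity-odd e) ⟨
      parity (suc (e * 2)) ℙ.* parity (suc a) ≡⟨ ℙ.*-homo-* (suc (e * 2)) (suc a) ⟨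
      parity (suc (e * 2) * suc a)            ≡⟨ cong parity ≡n*2 ⟩
      parity (n * 2)                          ≡⟨ parity-even n ⟩
      0ℙ                                      ∎))
    (*-zeroʳ (δ (suc (e * 2) * suc a) (n * 2)))
  even-cofactor : ∀ a e → F a (e * 2 + 1) ≡ δ (suc e * suc a) n * toℕ (parity (suc a))
  even-cofactor a e = cong (_* toℕ (parity (suc a))) (δ-resp-⇔ {suc (e * 2 + 1) * suc a} {n * 2} {suc e * suc a} {n}
    (λ ≡n*2 → *-cancelʳ-≡ _ _ 2 (trans (sym (halve a e)) ≡n*2))
    (λ ≡n → trans (halve a e) (cong (_* 2) ≡n)))
    where
    halve : ∀ a e → suc (e * 2 + 1) * suc a ≡ suc e * suc a * 2
    halve = solve-∀

oddFactorPairs-pow : ∀ L {M} k → 2 ^ k * M ≤ L → oddFactorPairs L (2 ^ k * M) ≡ oddFactorPairs L M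
oddFactorPairs-pow L {M} zero    _   = cong (oddFactorPairs L) (*-identityˡ M)
oddFactorPairs-pow L {M} (suc k) N≤L = begin
  oddFactorPairs L (2 ^ suc k * M) ≡⟨ cong (oddFactorPairs L) (2^[1+k]*m≡2^k*m*2 k M) ⟩
  oddFactorPairs L (2 ^ k * M * 2) ≡⟨ oddFactorPairs-double (2 ^ k * M) 2^k*M*2≤L ⟩
  oddFactorPairs L (2 ^ k * M)     ≡⟨ oddFactorPairs-pow L k (≤-trans (m≤m*n (2 ^ k * M) 2) 2^k*M*2≤L) ⟩
  oddFactorPairs L M               ∎
  where
  2^k*M*2≤L : 2 ^ k * M * 2 ≤ L
  2^k*M*2≤L = ≤-trans (≤-reflexive (sym (2^[1+k]*m≡2^k*m*2 k M))) N≤L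

oddFactorPairs-odd : ∀ L {M} → parity M ≡ 1ℙ → oddFactorPairs L M ≡ factorPairs L M
oddFactorPairs-odd L {M} M-odd = ∑-cong L λ a _ → ∑-cong L λ b _ →
  trans (δ-*-cong (suc b * suc a) M _ 1 λ ≡M →
           cong toℕ (proj₂ (parity-factors-of-odd (suc b) (suc a) (trans (cong parity ≡M) M-odd))))
        (*-identityʳ (δ (suc b * suc a) M))

oddGapPairs-even : ∀ k {M} → parity M ≡ 1ℙ → (∀ x → x * x ≢ M) → 2 ∣ oddGapPairs (2 ^ k * M)
oddGapPairs-even zero {M} M-odd _ = divides 0 (begin
  oddGapPairs (1 * M) ≡⟨ cong oddGapPairs (*-identityˡ M) ⟩
  oddGapPairs M       ≡⟨ oddGapPairs-odd M M-odd ⟩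
  0                   ∎)
oddGapPairs-even (suc k) {M} M-odd M≢x² = divides (increasingFactorPairs N M) (begin
  oddGapPairs N                     ≡⟨ oddGapPairs≡oddFactorPairs N N-even ⟩
  oddFactorPairs N N                ≡⟨ oddFactorPairs-pow N (suc k) ≤-refl ⟩
  oddFactorPairs N M                ≡⟨ oddFactorPairs-odd N M-odd ⟩
  factorPairs N M                   ≡⟨ factorPairs-nonsquare N M M≢x² ⟩
  2 * increasingFactorPairs N M     ≡⟨ *-comm 2 (increasingFactorPairs N M) ⟩
  increasingFactorPairs N M * 2     ∎)
  where
  N : ℕ
  N = 2 ^ suc k * M
  N-even : parity N ≡ 0ℙ
  N-even = trans (cong parity (2^[1+k]*m≡2^k*m*2 k M)) (parity-even (2 ^ k * M))

-- Arithmetic of 2^k (6m + 5)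

data EvenOdd : ℕ → Set where
  even : ∀ t → EvenOdd (t * 2)
  odd  : ∀ t → EvenOdd (1 + t * 2)

evenOdd : ∀ n → EvenOdd n
evenOdd zero = even 0
evenOdd (suc n) with evenOdd n
... | even t = odd t
... | odd  t = even (suc t)

odd≢even : ∀ a b → 1 + a * 2 ≢ b * 2
odd≢even a b eq = contradiction (trans (sym (parity-odd a)) (trans (cong parity eq) (parity-even b))) λ ()

pronic-even : ∀ p → ∃[ h ] p * suc p ≡ h * 2
pronic-even zero    = 0 , refl
pronic-even (suc p) = let h , p*sp≡h*2 = pronic-even p in h + suc p , (begin
  suc p * suc (suc p)     ≡⟨ step p ⟩
  p * suc p + suc p * 2   ≡⟨ cong (_+ suc p * 2) p*sp≡h*2 ⟩
  h * 2 + suc p * 2       ≡⟨ *-distribʳ-+ 2 h (suc p) ⟨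
  (h + suc p) * 2         ∎)
  where
  step : ∀ p → suc p * suc (suc p) ≡ p * suc p + suc p * 2
  step = solve-∀

x²+3y²-2-adic : ∀ x y → (∃[ h ] x * x + 3 * (y * y) ≡ 1 + h * 2)
                      ⊎ (∃[ h ] x * x + 3 * (y * y) ≡ 4 * (1 + h * 2))
                      ⊎ (∃[ p ] ∃[ r ] x ≡ p * 2 × y ≡ r * 2)
x²+3y²-2-adic x y with evenOdd x | evenOdd y
... | even p | even r = inj₂ (inj₂ (p , r , refl , refl))
... | even p | odd  r = inj₁ (1 + p * p * 2 + 3 * r * (1 + r) * 2 , expand p r)
  where
  expand : ∀ p r → p * 2 * (p * 2) + 3 * ((1 + r * 2) * (1 + r * 2)) ≡ 1 + (1 + p * p * 2 + 3 * r * (1 + r) * 2) * 2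
  expand = solve-∀
... | odd  p | even r = inj₁ (p * (1 + p) * 2 + r * r * 6 , expand p r)
  where
  expand : ∀ p r → (1 + p * 2) * (1 + p * 2) + 3 * (r * 2 * (r * 2)) ≡ 1 + (p * (1 + p) * 2 + r * r * 6) * 2
  expand = solve-∀
... | odd  p | odd  r = let h , p*sp≡h*2 = pronic-even p ; h′ , r*sr≡h′*2 = pronic-even r in
  inj₂ (inj₁ (h + 3 * h′ , (begin
    (1 + p * 2) * (1 + p * 2) + 3 * ((1 + r * 2) * (1 + r * 2))
      ≡⟨ expand p r ⟩
    4 * (1 + p * suc p + 3 * (r * suc r))
      ≡⟨ cong₂ (λ u v → 4 * (1 + u + 3 * v)) p*sp≡h*2 r*sr≡h′*2 ⟩
    4 * (1 + h * 2 + 3 * (h′ * 2))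
      ≡⟨ collect h h′ ⟩
    4 * (1 + (h + 3 * h′) * 2) ∎)))
  where
  expand : ∀ p r → (1 + p * 2) * (1 + p * 2) + 3 * ((1 + r * 2) * (1 + r * 2)) ≡ 4 * (1 + p * suc p + 3 * (r * suc r))
  expand = solve-∀
  collect : ∀ h h′ → 4 * (1 + h * 2 + 3 * (h′ * 2)) ≡ 4 * (1 + (h + 3 * h′) * 2)
  collect = solve-∀

4*z≢2*odd : ∀ z q → 4 * z ≢ 2 ^ 1 * (1 + q * 2)
4*z≢2*odd z q eq = odd≢even q z (sym (*-cancelˡ-≡ _ _ 2 (trans (lhs z) (trans eq (rhs q)))))
  where
  lhs : ∀ z → 2 * (z * 2) ≡ 4 * z
  lhs = solve-∀
  rhs : ∀ q → 2 ^ 1 * (1 + q * 2) ≡ 2 * (1 + q * 2)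
  rhs = solve-∀

cancel-4 : ∀ {z} t m → 4 * z ≡ 2 ^ (1 + suc t * 2) * m → z ≡ 2 ^ (1 + t * 2) * m
cancel-4 t m eq = *-cancelˡ-≡ _ _ 4 (trans eq (quadruple (2 ^ (t * 2)) m))
  where
  quadruple : ∀ p m → 2 * (2 * (2 * p)) * m ≡ 4 * (2 * p * m)
  quadruple = solve-∀

x²+3y²≢2^odd*odd : ∀ t x y q → x * x + 3 * (y * y) ≢ 2 ^ (1 + t * 2) * (1 + q * 2)
x²+3y²≢2^odd*odd t x y q eq with x²+3y²-2-adic x y
... | inj₁ (h , ≡odd) = odd≢even h (2 ^ (t * 2) * (1 + q * 2))
                          (trans (sym ≡odd) (trans eq (2^[1+k]*m≡2^k*m*2 (t * 2) (1 + q * 2))))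
... | inj₂ (inj₁ (h , ≡4*odd)) = 4*odd≢ t (trans (sym ≡4*odd) eq)
  where
  4*odd≢ : ∀ t → 4 * (1 + h * 2) ≢ 2 ^ (1 + t * 2) * (1 + q * 2)
  4*odd≢ zero    = 4*z≢2*odd (1 + h * 2) q
  4*odd≢ (suc t) = odd≢even h (2 ^ (t * 2) * (1 + q * 2))
                 ∘ (λ ≡2^ → trans ≡2^ (2^[1+k]*m≡2^k*m*2 (t * 2) (1 + q * 2))) ∘ cancel-4 t (1 + q * 2)
... | inj₂ (inj₂ (p , r , refl , refl)) = 4*[p²+3r²]≢ t (trans (quadruple p r) eq)
  where
  quadruple : ∀ p r → 4 * (p * p + 3 * (r * r)) ≡ p * 2 * (p * 2) + 3 * (r * 2 * (r * 2))
  quadruple = solve-∀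
  4*[p²+3r²]≢ : ∀ t → 4 * (p * p + 3 * (r * r)) ≢ 2 ^ (1 + t * 2) * (1 + q * 2)
  4*[p²+3r²]≢ zero    = 4*z≢2*odd (p * p + 3 * (r * r)) q
  4*[p²+3r²]≢ (suc t) = x²+3y²≢2^odd*odd t p r q ∘ cancel-4 t (1 + q * 2)

[x*x]%3≢2 : ∀ x → (x * x) % 3 ≢ 2
[x*x]%3≢2 x eq = residue (x % 3) (m%n<n x 3) (trans (sym (%-distribˡ-* x x 3)) eq)
  where
  residue : ∀ r → r < 3 → (r * r) % 3 ≢ 2
  residue 0 _ ()
  residue 1 _ ()
  residue 2 _ ()
  residue (suc (suc (suc _))) (s≤s (s≤s (s≤s ())))

[4^t*m]%3≡m%3 : ∀ t m → (2 ^ (t * 2) * m) % 3 ≡ m % 3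
[4^t*m]%3≡m%3 zero    m = cong (_% 3) (*-identityˡ m)
[4^t*m]%3≡m%3 (suc t) m = begin
  (2 * (2 * 2 ^ (t * 2)) * m) % 3              ≡⟨ cong (_% 3) (four-times (2 ^ (t * 2)) m) ⟩
  (2 ^ (t * 2) * m + 2 ^ (t * 2) * m * 3) % 3  ≡⟨ [m+kn]%n≡m%n (2 ^ (t * 2) * m) (2 ^ (t * 2) * m) 3 ⟩
  (2 ^ (t * 2) * m) % 3                        ≡⟨ [4^t*m]%3≡m%3 t m ⟩
  m % 3                                        ∎
  where
  four-times : ∀ p m → 2 * (2 * p) * m ≡ p * m + p * m * 3
  four-times = solve-∀

x²+3y²≢4^t*[6m+5] : ∀ t m x y → x * x + 3 * (y * y) ≢ 2 ^ (t * 2) * (6 * m + 5)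
x²+3y²≢4^t*[6m+5] t m x y eq = [x*x]%3≢2 x (begin
  (x * x) % 3                     ≡⟨ %-remove-+ʳ (x * x) (m∣m*n (y * y)) ⟨
  (x * x + 3 * (y * y)) % 3       ≡⟨ cong (_% 3) eq ⟩
  (2 ^ (t * 2) * (6 * m + 5)) % 3 ≡⟨ [4^t*m]%3≡m%3 t (6 * m + 5) ⟩
  (6 * m + 5) % 3                 ≡⟨ cong (_% 3) (regroup m) ⟩
  (2 + (2 * m + 1) * 3) % 3       ≡⟨ [m+kn]%n≡m%n 2 (2 * m + 1) 3 ⟩
  2                               ∎)
  where
  regroup : ∀ m → 6 * m + 5 ≡ 2 + (2 * m + 1) * 3
  regroup = solve-∀

6m+5≡1+[3m+2]*2 : ∀ m → 6 * m + 5 ≡ 1 + (3 * m + 2) * 2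
6m+5≡1+[3m+2]*2 = solve-∀

x²+3y²≢2^k*[6m+5] : ∀ k m x y → x * x + 3 * (y * y) ≢ 2 ^ k * (6 * m + 5)
x²+3y²≢2^k*[6m+5] k m x y with evenOdd k
... | even t = x²+3y²≢4^t*[6m+5] t m x y
... | odd  t = x²+3y²≢2^odd*odd t x y (3 * m + 2) ∘ λ eq → trans eq (cong (2 ^ (1 + t * 2) *_) (6m+5≡1+[3m+2]*2 m))

3-prime : Prime 3
3-prime = from-yes (prime? 3)

3∤2^k : ∀ k → ¬ 3 ∣ 2 ^ k
3∤2^k zero    = from-no (3 ∣? 1)
3∤2^k (suc k) 3∣2*2^k with euclidsLemma 2 (2 ^ k) 3-prime 3∣2*2^k
... | inj₁ 3∣2   = from-no (3 ∣? 2) 3∣2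
... | inj₂ 3∣2^k = 3∤2^k k 3∣2^k

3∤2^k*[6m+5] : ∀ k m → ¬ 3 ∣ 2 ^ k * (6 * m + 5)
3∤2^k*[6m+5] k m 3∣N with euclidsLemma (2 ^ k) (6 * m + 5) 3-prime 3∣N
... | inj₁ 3∣2^k   = 3∤2^k k 3∣2^k
... | inj₂ 3∣6m+5 = from-no (3 ∣? 5) (∣m+n∣m⇒∣n 3∣6m+5 (∣m⇒∣m*n m (divides 2 refl)))

mainTheorem8 : (k m : ℕ) → 8 ∣ C̄₃₁ (2 ^ k * (6 * m + 5))
mainTheorem8 k m =
  8∣W-from-2∣oddGapPairs (3∤2^k*[6m+5] k m) (x²+3y²≢2^k*[6m+5] k m) (oddGapPairs-even k M-odd M-nonsquare)
  where
  M-odd : parity (6 * m + 5) ≡ 1ℙ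
  M-odd = trans (cong parity (6m+5≡1+[3m+2]*2 m)) (parity-odd (3 * m + 2))
  M-nonsquare : ∀ x → x * x ≢ 6 * m + 5
  M-nonsquare x eq = x²+3y²≢2^k*[6m+5] 0 m x 0 (trans (+-identityʳ (x * x)) (trans eq (sym (*-identityˡ _))))
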